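{- Let $W$ be a square-free word of length $n$ over a finite alphabet. Let $\mathcal{A}$ be a set of square-completing quadruples $(a, \ell, b, c)$ in $W$ such that no two elements of $\mathcal{A}$ have the same pair $(b, c)$. For each integer $L \ge 2$, let $\mathcal{A}_L = \{(a, \ell, b, c) \in \mathcal{A} : \ell = L\}$. Then for every $L \ge 2$, $$|\mathcal{A}_L| \le \frac{2n}{L-1},$$ and for every $L \ge 300$, $$\sum_{\ell = L}^{2L-1} |\mathcal{A}_\ell| \le \frac{320 n}{L}.$$
   Context: A square is a nonempty word of the form $XX$; a word is square-free if no factor (block of consecutive letters) is a square. For a word $W$ of length $n$, number its letters $1, 2, \ldots, n$ from left to right. For $1 \le i \le n-1$, gap $i$ is the position between letter $i$ and letter $i+1$; gap $0$ is the position before letter $1$ and gap $n$ the position after letter $n$. For integers $0 < a < b \le m+1$ and a word $V$ of length $m$, $V[a, b)$ denotes the factor of $V$ consisting of letters $a, a+1, \ldots, b-1$. For $0 \le b \le n$ and a letter $c$, $W +_b c$ denotes the word of length $n+1$ obtained by inserting $c$ at gap $b$ of $W$ (so $c$ is letter $b+1$ of $W +_b c$). For positive integers $a, b$ with $a \le b+1$ (and $b \le n$), a positive integer $\ell$ (with $a + 2\ell \le n+2$) and a letter $c$, the quadruple $(a, \ell, b, c)$ is square-completing in $W$ if $(W +_b c)[a, a+\ell) = (W +_b c)[a+\ell, a+2\ell)$. -}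

module Defs where

open import Data.Nat using (ℕ; zero; suc; _+_; _*_; _∸_; _≤_; _<_; _≟_)
open import Data.Fin using (Fin)
open import Data.List using (List; []; _∷_; _++_; take; drop; length; filter; map; sum)
open import Data.List.Relation.Unary.Unique.Propositional using (Unique)
open import Data.List.Relation.Unary.All using (All)
open import Data.Product using (_×_; _,_)
open import Relation.Binary.PropositionalEquality using (_≡_)

Word : ℕ → Set
Word k = List (Fin k)

SquareFree : ∀ {k} → Word k → Set
SquareFree W = ∀ U X V → W ≡ U ++ (X ++ (X ++ V)) → X ≡ []

-- V[a, b) : letters a, ..., b-1 (letters numbered from 1).
factor : ∀ {k} → Word k → ℕ → ℕ → Word k
factor V a b = take (b ∸ a) (drop (a ∸ 1) V)

-- W +_b c : insert c at gap b (so c becomes letter b+1).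
insertAt : ∀ {k} → Word k → ℕ → Fin k → Word k
insertAt W b c = take b W ++ (c ∷ drop b W)

record Quad (k : ℕ) : Set where
  constructor quad
  field
    qa : ℕ
    qℓ : ℕ
    qb : ℕ
    qc : Fin k
open Quad public

SquareCompleting : ∀ {k} → Word k → Quad k → Set
SquareCompleting W (quad a ℓ b c) =
  (0 < a) × (a ≤ suc b) × (b ≤ length W) × (0 < ℓ) × (a + 2 * ℓ ≤ length W + 2) ×
  (factor (insertAt W b c) a (a + ℓ) ≡ factor (insertAt W b c) (a + ℓ) (a + 2 * ℓ))

bc : ∀ {k} → Quad k → ℕ × Fin k
bc q = qb q , qc q

-- A finite set 𝒜 of square-completing quadruples in W, no two of which share (b, c),
-- represented by a list whose (b, c)-pairs are pairwise distinct (hence so are its elements).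
record CompletingSet {k : ℕ} (W : Word k) : Set where
  constructor mkCompletingSet
  field
    elems     : List (Quad k)
    allComp   : All (SquareCompleting W) elems
    bcDistinct : Unique (map bc elems)
open CompletingSet public

countL : ∀ {k} {W : Word k} → CompletingSet W → ℕ → ℕ
countL 𝒜 L = length (filter (λ q → qℓ q ≟ L) (elems 𝒜))

sumCount : ∀ {k} {W : Word k} → CompletingSet W → ℕ → ℕ → ℕ
sumCount 𝒜 L zero = 0
sumCount 𝒜 L (suc m) = countL 𝒜 L + sumCount 𝒜 (suc L) m

{-# OPTIONS --safe #-}

-- Positions in W are counted from 0, so the square of a quadruple (a, ℓ, b, c) starts at s = a - 1;
-- write m = ℓ - 1. Deleting the inserted letter from the square shows that the window [s, s + m) of W
-- is split at a point d into two parts whose periods differ by one: if b < s + ℓ, then d = b, W has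
-- period m on [s, d) and period ℓ on [d, s + m), and c = W[d + m]; otherwise d = b - ℓ, W has period ℓ
-- on [s, d) and period m on [d + 1, s + m + 1), and c = W[d].
-- In a square-free word, W[x] = W[x + p] cannot hold for p consecutive positions x, and it cannot hold
-- for two periods p < p′ on p′ - p common consecutive positions. Hence for a fixed length and a fixed
-- half, distinct (b, c) have distinct split points and then disjoint windows: |𝒜_L| (L - 1) ≤ 2n.
-- For lengths in a bucket [L₀, L₀ + 2r + 2), cut r positions from both ends of every part: parts of
-- the same half and side of different quadruples become disjoint, while the two parts of a quadruple
-- keep total width at least L₀ - 1 - 4r. So (L₀ - 1 - 4r) times the size of the bucket is at most 4n,
-- and four buckets with r = ⌊L/8⌋ cover [L, 2L), giving L Σ_{ℓ=L}^{2L-1} |𝒜_ℓ| ≤ 48n for L ≥ 8.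

module Submission where

open import Defs
open import Data.Fin using (Fin)
open import Data.Nat using (ℕ; zero; suc; _+_; _*_; _∸_; _≤_; _<_; _≟_; z≤n; s≤s; z<s; _≤?_; _<?_)
open import Data.Nat.Properties
open import Data.Nat.DivMod using (_/_; _%_; m≡m%n+[m/n]*n; m%n<n)
open import Data.Nat.Tactic.RingSolver using (solve-∀)
open import Data.List using (List; []; _∷_; _++_; take; drop; length; filter; map)
open import Data.Nat.ListAction using (sum)
open import Data.List.Properties using (take++drop≡id; drop-drop; map-∘)
open import Data.List.Relation.Unary.All as All using (All; []; _∷_)
open import Data.List.Relation.Unary.All.Properties using (all-filter) renaming (filter⁺ to All-filter⁺; map⁺ to All-map⁺)
open import Data.List.Relation.Unary.AllPairs using (AllPairs; []; _∷_)
import Data.List.Relation.Unary.AllPairs.Properties as AllPairs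
open import Data.List.Relation.Ternary.Interleaving.Properties using (interleave-length)
open import Data.List.Relation.Ternary.Interleaving.Propositional.Properties using () renaming (filter⁺ to interleave-filter)
open import Algebra.Properties.CommutativeSemigroup +-commutativeSemigroup using (interchange; xy∙z≈xz∙y)
open import Relation.Unary using (Decidable)
open import Function using (_∘_)
open import Data.Maybe using (Maybe; just; nothing)
open import Data.Maybe.Properties using (just-injective)
open import Data.Product using (_×_; _,_; proj₁; proj₂; ∃-syntax)
open import Data.Empty using (⊥; ⊥-elim)
open import Relation.Nullary using (¬_; Dec; yes; no; ¬?; _×-dec_)
open import Relation.Binary.PropositionalEquality
open import Relation.Binary.Definitions using (Tri; tri<; tri≈; tri>)

at : ∀ {A : Set} → List A → ℕ → Maybe A
at []       _       = nothing
at (x ∷ xs) zero    = just x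
at (x ∷ xs) (suc i) = at xs i

module _ {A : Set} where

  at-just : ∀ (xs : List A) {i} → i < length xs → ∃[ a ] at xs i ≡ just a
  at-just (x ∷ xs) {zero}  _         = x , refl
  at-just (x ∷ xs) {suc i} (s≤s i<n) = at-just xs i<n

  at-take : ∀ (xs : List A) {m i} → i < m → at (take m xs) i ≡ at xs i
  at-take []       {suc m}         _         = refl
  at-take (x ∷ xs) {suc m} {zero}  _         = refl
  at-take (x ∷ xs) {suc m} {suc i} (s≤s i<m) = at-take xs i<m

  at-drop : ∀ m (xs : List A) i → at (drop m xs) i ≡ at xs (m + i)
  at-drop zero    xs       i = refl
  at-drop (suc m) []       i = refl
  at-drop (suc m) (x ∷ xs) i = at-drop m xs i

  take-cong-at : ∀ m (xs ys : List A) → (∀ {i} → i < m → at xs i ≡ at ys i) → take m xs ≡ take m ys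
  take-cong-at zero    xs       ys       _  = refl
  take-cong-at (suc m) []       []       _  = refl
  take-cong-at (suc m) []       (y ∷ ys) eq with () ← eq z<s
  take-cong-at (suc m) (x ∷ xs) []       eq with () ← eq z<s
  take-cong-at (suc m) (x ∷ xs) (y ∷ ys) eq =
    cong₂ _∷_ (just-injective (eq z<s)) (take-cong-at m xs ys (λ i<m → eq (s≤s i<m)))

  drop-split : ∀ i p (xs : List A) → drop i xs ≡ take p (drop i xs) ++ drop (i + p) xs
  drop-split i p xs = trans (sym (take++drop≡id p (drop i xs))) (cong (take p (drop i xs) ++_) (drop-drop i p xs))

at-factor : ∀ {k} (V : Word k) s j {t} → t < j ∸ suc s → at (factor V (suc s) j) t ≡ at V (s + t)
at-factor V s j t<len = trans (at-take (drop s V) t<len) (at-drop s V _)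

module _ {k} (c : Fin k) where

  length-insertAt : ∀ (W : Word k) {b} → b ≤ length W → length (insertAt W b c) ≡ suc (length W)
  length-insertAt W       {zero}  _         = refl
  length-insertAt (w ∷ W) {suc b} (s≤s b≤n) = cong suc (length-insertAt W b≤n)

  at-insertAt-< : ∀ (W : Word k) {b x} → b ≤ length W → x < b → at (insertAt W b c) x ≡ at W x
  at-insertAt-< (w ∷ W) {suc b} {zero}  _         _         = refl
  at-insertAt-< (w ∷ W) {suc b} {suc x} (s≤s b≤n) (s≤s x<b) = at-insertAt-< W b≤n x<b

  at-insertAt-≡ : ∀ (W : Word k) {b} → b ≤ length W → at (insertAt W b c) b ≡ just c
  at-insertAt-≡ W       {zero}  _         = refl
  at-insertAt-≡ (w ∷ W) {suc b} (s≤s b≤n) = at-insertAt-≡ W b≤n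

  at-insertAt-> : ∀ (W : Word k) {b x} → b ≤ x → at (insertAt W b c) (suc x) ≡ at W x
  at-insertAt-> W       {zero}          _         = refl
  at-insertAt-> []      {suc b} {suc x} _         = refl
  at-insertAt-> (w ∷ W) {suc b} {suc x} (s≤s b≤x) = at-insertAt-> W b≤x

record SameLetter {A : Set} (W : List A) (i j : ℕ) : Set where
  constructor sameLetter
  field
    letter : A
    at-i   : at W i ≡ just letter
    at-j   : at W j ≡ just letter

PeriodAt : ∀ {A : Set} → List A → ℕ → ℕ → Set
PeriodAt W p x = SameLetter W x (x + p)

module _ {A : Set} {W : List A} where

  SameLetter-sym : ∀ {i j} → SameLetter W i j → SameLetter W j i
  SameLetter-sym (sameLetter a wi wj) = sameLetter a wj wi

  SameLetter-trans : ∀ {i j l} → SameLetter W i j → SameLetter W j l → SameLetter W i l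
  SameLetter-trans (sameLetter a wi wj) (sameLetter b wj′ wl) = sameLetter a wi (trans wl (trans (sym wj′) wj))

  SameLetter-at : ∀ {i j x} → SameLetter W i j → at W i ≡ x → at W j ≡ x
  SameLetter-at (sameLetter a wi wj) wi≡x = trans wj (trans (sym wi) wi≡x)

  SameLetter-transport : ∀ {V : List A} {i j i′ j′} → at W i ≡ at V i′ → at W j ≡ at V j′ →
    SameLetter W i j → SameLetter V i′ j′
  SameLetter-transport eqi eqj (sameLetter a wi wj) = sameLetter a (trans (sym eqi) wi) (trans (sym eqj) wj)

record Interval : Set where
  constructor [_,_⟩
  field
    lo hi : ℕ
open Interval

infix 4 _∈_ _∈?_ _⊆_

_∈_ : ℕ → Interval → Set
y ∈ I = lo I ≤ y × y < hi I

_∈?_ : ∀ y I → Dec (y ∈ I)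
y ∈? I = (lo I ≤? y) ×-dec (y <? hi I)

_⊆_ : Interval → Interval → Set
I ⊆ J = ∀ y → y ∈ I → y ∈ J

Run : (ℕ → Set) → Interval → Set
Run P I = ∀ y → y ∈ I → P y

Disjoint : Interval → Interval → Set
Disjoint I J = ∀ y → y ∈ I → y ∈ J → ⊥

width : Interval → ℕ
width I = hi I ∸ lo I

shrink : ℕ → Interval → Interval
shrink r I = [ lo I + r , hi I ∸ r ⟩

⊆-bounds : ∀ {I J} → lo J ≤ lo I → hi I ≤ hi J → I ⊆ J
⊆-bounds lo≤ ≤hi y (lo≤y , y<hi) = ≤-trans lo≤ lo≤y , <-≤-trans y<hi ≤hi

shrink-⊆ : ∀ r I → shrink r I ⊆ I
shrink-⊆ r I = ⊆-bounds (m≤m+n (lo I) r) (m∸n≤m (hi I) r)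

Run-⊆ : ∀ {P I J} → I ⊆ J → Run P J → Run P I
Run-⊆ I⊆J run y y∈I = run y (I⊆J y y∈I)

Run-join : ∀ {P a b c e} → c ≤ b → Run P [ a , b ⟩ → Run P [ c , e ⟩ → Run P [ a , e ⟩
Run-join {b = b} c≤b run run′ y (a≤y , y<e) with y <? b
... | yes y<b = run y (a≤y , y<b)
... | no  y≮b = run′ y (≤-trans c≤b (≮⇒≥ y≮b) , y<e)

Run-suc : ∀ {P : ℕ → Set} {i j} → Run (λ x → P (suc x)) [ i , j ⟩ → Run P [ suc i , suc j ⟩
Run-suc run (suc y) (s≤s i≤y , s≤s y<j) = run y (i≤y , y<j)

Disjoint-sym : ∀ {I J} → Disjoint I J → Disjoint J I
Disjoint-sym dis y y∈J y∈I = dis y y∈I y∈J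

Disjoint-⊆ : ∀ {I I′ J J′} → I ⊆ I′ → J ⊆ J′ → Disjoint I′ J′ → Disjoint I J
Disjoint-⊆ I⊆I′ J⊆J′ dis y y∈I y∈J = dis y (I⊆I′ y y∈I) (J⊆J′ y y∈J)

empty-Disjoint : ∀ {I} J → hi I ≤ lo I → Disjoint I J
empty-Disjoint J hi≤lo y (lo≤y , y<hi) _ = <-irrefl refl (<-≤-trans y<hi (≤-trans hi≤lo lo≤y))

width-shrink : ∀ r I → width (shrink r I) ≡ width I ∸ 2 * r
width-shrink r I = begin
  hi I ∸ r ∸ (lo I + r)      ≡⟨ ∸-+-assoc (hi I) r (lo I + r) ⟩
  hi I ∸ (r + (lo I + r))    ≡⟨ cong (hi I ∸_) (regroup r (lo I)) ⟩
  hi I ∸ (lo I + 2 * r)      ≡⟨ ∸-+-assoc (hi I) (lo I) (2 * r) ⟨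
  hi I ∸ lo I ∸ 2 * r        ∎
  where
  open ≡-Reasoning
  regroup : ∀ r l → r + (l + r) ≡ l + 2 * r
  regroup = solve-∀

[m+n]∸[o+o]≤m∸o+n∸o : ∀ a b c → a + b ∸ (c + c) ≤ (a ∸ c) + (b ∸ c)
[m+n]∸[o+o]≤m∸o+n∸o a b c = m≤n+o⇒m∸n≤o (a + b) (c + c) (begin
  a + b                             ≤⟨ +-mono-≤ (m≤n+m∸n a c) (m≤n+m∸n b c) ⟩
  c + (a ∸ c) + (c + (b ∸ c))       ≡⟨ interchange c (a ∸ c) c (b ∸ c) ⟩
  c + c + ((a ∸ c) + (b ∸ c))       ∎)
  where open ≤-Reasoning

split-widths : ∀ {t d m} → t ≤ d → d ≤ t + m → width [ t , d ⟩ + width [ d , t + m ⟩ ≡ m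
split-widths {t} {d} {m} t≤d d≤t+m = +-cancelˡ-≡ t _ _ (begin
  t + ((d ∸ t) + (t + m ∸ d))   ≡⟨ +-assoc t (d ∸ t) _ ⟨
  t + (d ∸ t) + (t + m ∸ d)     ≡⟨ cong (_+ (t + m ∸ d)) (m+[n∸m]≡n t≤d) ⟩
  d + (t + m ∸ d)               ≡⟨ m+[n∸m]≡n d≤t+m ⟩
  t + m                         ∎)
  where open ≡-Reasoning

shrunk-split-widths : ∀ r {t d m} → t ≤ d → d ≤ t + m →
  m ∸ 4 * r ≤ width (shrink r [ t , d ⟩) + width (shrink r [ d , t + m ⟩)
shrunk-split-widths r {t} {d} {m} t≤d d≤t+m = begin
  m ∸ 4 * r                                    ≡⟨ cong₂ _∸_ (split-widths t≤d d≤t+m) (double r) ⟨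
  width I₁ + width I₂ ∸ (2 * r + 2 * r)        ≤⟨ [m+n]∸[o+o]≤m∸o+n∸o (width I₁) (width I₂) (2 * r) ⟩
  (width I₁ ∸ 2 * r) + (width I₂ ∸ 2 * r)      ≡⟨ cong₂ _+_ (width-shrink r I₁) (width-shrink r I₂) ⟨
  width (shrink r I₁) + width (shrink r I₂)    ∎
  where
  open ≤-Reasoning
  I₁ = [ t , d ⟩
  I₂ = [ d , t + m ⟩
  double : ∀ r → 2 * r + 2 * r ≡ 4 * r
  double = solve-∀

m<n∸o⇒m+o<n : ∀ {y h} r → y < h ∸ r → y + r < h
m<n∸o⇒m+o<n {y} {h} r y<h∸r with r ≤? h
... | yes r≤h = m≤o∸n⇒m+n≤o (suc y) r≤h y<h∸r
... | no  r≰h = ⊥-elim (n≮0 (subst (y <_) (m≤n⇒m∸n≡0 (<⇒≤ (≰⇒> r≰h))) y<h∸r))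

Conflicting : (ℕ → ℕ → Set) → Set
Conflicting F = ∀ {m e I} → 0 < e → lo I + e ≤ hi I → Run (F m) I → ¬ Run (F (m + e)) I

-- A common point y of the shrunk intervals is the centre of the stretch [y - r, y + r] lying in both
-- runs, whose length 2r + 1 is at least m′ - m.
shrunk-runs-disjoint : ∀ {F : ℕ → ℕ → Set} r {m m′ I I′} → Conflicting F →
  Run (F m) I → Run (F m′) I′ → m < m′ → m′ ≤ m + suc (2 * r) → Disjoint (shrink r I) (shrink r I′)
shrunk-runs-disjoint {F} r {m} {m′} {I} conflict run run′ m<m′ m′≤m+r′
                     y (lo+r≤y , y<hi∸r) (lo′+r≤y , y<hi′∸r) =
  conflict {I = core} (m<n⇒0<n∸m m<m′) core-long (Run-⊆ (core⊆ lo+r≤y y<hi∸r) run)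
    (subst (λ p → Run (F p) core) (sym (m+[n∸m]≡n (<⇒≤ m<m′))) (Run-⊆ (core⊆ lo′+r≤y y<hi′∸r) run′))
  where
  core = [ y ∸ r , suc y + r ⟩
  core⊆ : ∀ {K} → lo K + r ≤ y → y < hi K ∸ r → core ⊆ K
  core⊆ lo+r≤y y<hi∸r = ⊆-bounds (m+n≤o⇒m≤o∸n _ lo+r≤y) (m<n∸o⇒m+o<n r y<hi∸r)
  core-long : y ∸ r + (m′ ∸ m) ≤ suc y + r
  core-long = begin
    y ∸ r + (m′ ∸ m)       ≤⟨ +-monoʳ-≤ (y ∸ r) (m≤n+o⇒m∸n≤o m′ m m′≤m+r′) ⟩
    y ∸ r + suc (2 * r)    ≡⟨ regroup (y ∸ r) r ⟩
    y ∸ r + r + suc r      ≡⟨ cong (_+ suc r) (m∸n+n≡m (m+n≤o⇒n≤o (lo I) lo+r≤y)) ⟩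
    y + suc r              ≡⟨ +-suc y r ⟩
    suc y + r              ∎
    where
    open ≤-Reasoning
    regroup : ∀ a r → a + suc (2 * r) ≡ a + r + suc r
    regroup = solve-∀

sumBelow : ℕ → (ℕ → ℕ) → ℕ
sumBelow zero    f = 0
sumBelow (suc n) f = sumBelow n f + f n

syntax sumBelow n (λ y → e) = ∑[ y < n ] e

∑-+ : ∀ n (f g : ℕ → ℕ) → ∑[ y < n ] (f y + g y) ≡ ∑[ y < n ] f y + ∑[ y < n ] g y
∑-+ zero    f g = refl
∑-+ (suc n) f g = trans (cong (_+ (f n + g n)) (∑-+ n f g)) (interchange (∑[ y < n ] f y) (∑[ y < n ] g y) (f n) (g n))

∑-≤-∑-+ : ∀ m k (f : ℕ → ℕ) → ∑[ y < m ] f y ≤ ∑[ y < m + k ] f y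
∑-≤-∑-+ m zero    f = ≤-reflexive (cong (λ n → ∑[ y < n ] f y) (sym (+-identityʳ m)))
∑-≤-∑-+ m (suc k) f rewrite +-suc m k = ≤-trans (∑-≤-∑-+ m k f) (m≤m+n _ (f (m + k)))

∑-mono : ∀ {m n} (f : ℕ → ℕ) → m ≤ n → ∑[ y < m ] f y ≤ ∑[ y < n ] f y
∑-mono {m} f m≤n = subst (λ n → _ ≤ ∑[ y < n ] f y) (m+[n∸m]≡n m≤n) (∑-≤-∑-+ m _ f)

∑-≤ : ∀ n (f : ℕ → ℕ) → (∀ y → f y ≤ 1) → ∑[ y < n ] f y ≤ n
∑-≤ zero    f f≤1 = z≤n
∑-≤ (suc n) f f≤1 = ≤-trans (+-mono-≤ (∑-≤ n f f≤1) (f≤1 n)) (≤-reflexive (+-comm n 1))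

indicator : ∀ {P : Set} → Dec P → ℕ
indicator (yes _) = 1
indicator (no _)  = 0

width-≤-∑ : ∀ {n} I → hi I ≤ n → width I ≤ ∑[ y < n ] indicator (y ∈? I)
width-≤-∑ {n} I hi≤n with lo I ≤? hi I
... | no  lo≰hi = ≤-trans (≤-reflexive (m≤n⇒m∸n≡0 (<⇒≤ (≰⇒> lo≰hi)))) z≤n
... | yes lo≤hi = ≤-trans (prefix (width I) (≤-reflexive (m+[n∸m]≡n lo≤hi)))
                          (∑-mono _ (≤-trans (≤-reflexive (m+[n∸m]≡n lo≤hi)) hi≤n))
  where
  prefix : ∀ w → lo I + w ≤ hi I → w ≤ ∑[ y < lo I + w ] indicator (y ∈? I)
  prefix zero    _  = z≤n
  prefix (suc w) le rewrite +-suc (lo I) w with lo I + w ∈? I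
  ... | yes _    = ≤-trans (≤-reflexive (+-comm 1 w)) (+-monoˡ-≤ 1 (prefix w (<⇒≤ le)))
  ... | no  ∉I   = ⊥-elim (∉I (m≤m+n (lo I) w , le))

multiplicity : List Interval → ℕ → ℕ
multiplicity Is y = sum (map (λ I → indicator (y ∈? I)) Is)

multiplicity-≡0 : ∀ {Is y} → All (λ I → ¬ y ∈ I) Is → multiplicity Is y ≡ 0
multiplicity-≡0 []                      = refl
multiplicity-≡0 {I ∷ _} {y} (y∉I ∷ y∉Is) with y ∈? I
... | yes y∈I = ⊥-elim (y∉I y∈I)
... | no  _   = multiplicity-≡0 y∉Is

multiplicity-≤1 : ∀ {Is} y → AllPairs Disjoint Is → multiplicity Is y ≤ 1
multiplicity-≤1 y []                        = z≤n
multiplicity-≤1 {I ∷ _} y (disjoint ∷ pairs) with y ∈? I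
... | yes y∈I = ≤-reflexive (cong suc (multiplicity-≡0 (All.map (λ dis y∈J → dis y y∈I y∈J) disjoint)))
... | no  _   = multiplicity-≤1 y pairs

widths-≤-∑-multiplicity : ∀ {n Is} → All (λ I → hi I ≤ n) Is → sum (map width Is) ≤ ∑[ y < n ] multiplicity Is y
widths-≤-∑-multiplicity             []                 = z≤n
widths-≤-∑-multiplicity {n} {I ∷ Is} (hi≤n ∷ his≤n) =
  ≤-trans (+-mono-≤ (width-≤-∑ I hi≤n) (widths-≤-∑-multiplicity his≤n))
          (≤-reflexive (sym (∑-+ n (λ y → indicator (y ∈? I)) (multiplicity Is))))

disjoint-widths : ∀ {n Is} → All (λ I → hi I ≤ n) Is → AllPairs Disjoint Is → sum (map width Is) ≤ n
disjoint-widths {n} his≤n pairs =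
  ≤-trans (widths-≤-∑-multiplicity his≤n) (∑-≤ n _ (λ y → multiplicity-≤1 y pairs))

module _ {A : Set} where

  All-filter : ∀ {P Q : A → Set} (Q? : Decidable Q) {xs} → All P xs → All (λ x → P x × Q x) (filter Q? xs)
  All-filter Q? {xs} ps = All.zip (All-filter⁺ Q? ps , all-filter Q? xs)

  AllPairs-with-All : ∀ {P : A → Set} {R S : A → A → Set} {xs} → (∀ {x y} → P x → P y → R x y → S x y) →
    All P xs → AllPairs R xs → AllPairs S xs
  AllPairs-with-All f []         []         = []
  AllPairs-with-All f (px ∷ pxs) (rx ∷ rxs) = All.zipWith (λ (py , r) → f px py r) (pxs , rx) ∷ AllPairs-with-All f pxs rxs

  length-filter-split : ∀ {P : A → Set} (P? : Decidable P) xs →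
    length xs ≡ length (filter P? xs) + length (filter (λ x → ¬? (P? x)) xs)
  length-filter-split P? xs = interleave-length (interleave-filter P? xs)

  length-filter-⊎ : ∀ {P Q R : A → Set} (P? : Decidable P) (Q? : Decidable Q) (R? : Decidable R) →
    (∀ {x} → P x → ¬ Q x) → (∀ {x} → P x → R x) → (∀ {x} → Q x → R x) →
    ∀ xs → length (filter P? xs) + length (filter Q? xs) ≤ length (filter R? xs)
  length-filter-⊎ P? Q? R? P⇒¬Q P⇒R Q⇒R [] = z≤n
  length-filter-⊎ P? Q? R? P⇒¬Q P⇒R Q⇒R (x ∷ xs)
    with P? x | Q? x | R? x | length-filter-⊎ P? Q? R? P⇒¬Q P⇒R Q⇒R xs
  ... | yes px | yes qx | _      | _  = ⊥-elim (P⇒¬Q px qx)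
  ... | yes px | no  _  | no ¬rx | _  = ⊥-elim (¬rx (P⇒R px))
  ... | no  _  | yes qx | no ¬rx | _  = ⊥-elim (¬rx (Q⇒R qx))
  ... | yes _  | no  _  | yes _  | ih = s≤s ih
  ... | no  _  | yes _  | yes _  | ih = ≤-trans (≤-reflexive (+-suc _ _)) (s≤s ih)
  ... | no  _  | no  _  | yes _  | ih = m≤n⇒m≤1+n ih
  ... | no  _  | no  _  | no  _  | ih = ih

  length*c≤sum : ∀ {c} (f : A → ℕ) {xs} → All (λ x → c ≤ f x) xs → length xs * c ≤ sum (map f xs)
  length*c≤sum f []           = z≤n
  length*c≤sum f (c≤fx ∷ c≤f) = +-mono-≤ c≤fx (length*c≤sum f c≤f)

  sum-map-+ : ∀ (f g : A → ℕ) xs → sum (map (λ x → f x + g x) xs) ≡ sum (map f xs) + sum (map g xs)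
  sum-map-+ f g []       = refl
  sum-map-+ f g (x ∷ xs) = trans (cong (f x + g x +_) (sum-map-+ f g xs)) (interchange (f x) (g x) _ _)

-- Square-free words

module _ {k} {W : Word k} (sf : SquareFree W) where

  no-periodic-run : ∀ {p z} → 0 < p → ¬ Run (PeriodAt W p) [ z , z + p ⟩
  no-periodic-run {p} {z} 0<p run with run z (≤-refl , m<m+n z 0<p)
  ... | sameLetter a Wz≡a _ = X≢[] (sf (take z W) X (drop (z + p + p) W) W≡UXXV)
    where
    X = take p (drop z W)
    X≡Y : X ≡ take p (drop (z + p) W)
    X≡Y = take-cong-at p _ _ λ {i} i<p → begin
      at (drop z W) i             ≡⟨ at-drop z W i ⟩
      at W (z + i)                ≡⟨ same (run (z + i) (m≤m+n z i , +-monoʳ-< z i<p)) ⟩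
      at W (z + i + p)            ≡⟨ cong (at W) (xy∙z≈xz∙y z i p) ⟩
      at W (z + p + i)            ≡⟨ at-drop (z + p) W i ⟨
      at (drop (z + p) W) i       ∎
      where
      open ≡-Reasoning
      same : ∀ {x y} → SameLetter W x y → at W x ≡ at W y
      same (sameLetter _ Wx Wy) = trans Wx (sym Wy)
    W≡UXXV : W ≡ take z W ++ (X ++ (X ++ drop (z + p + p) W))
    W≡UXXV = begin
      W                                                   ≡⟨ take++drop≡id z W ⟨
      take z W ++ drop z W                                ≡⟨ cong (take z W ++_) (drop-split z p W) ⟩
      take z W ++ (X ++ drop (z + p) W)                   ≡⟨ cong (λ V → take z W ++ (X ++ V)) (drop-split (z + p) p W) ⟩
      take z W ++ (X ++ (take p (drop (z + p) W) ++ V))   ≡⟨ cong (λ Y → take z W ++ (X ++ (Y ++ V))) X≡Y ⟨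
      take z W ++ (X ++ (X ++ V))                         ∎
      where
      open ≡-Reasoning
      V = drop (z + p + p) W
    X≢[] : X ≢ []
    X≢[] X≡[] with () ← trans (sym (cong (λ V → at V 0) X≡[]))
                              (trans (at-take (drop z W) 0<p) (trans (at-drop z W 0) (trans (cong (at W) (+-identityʳ z)) Wz≡a)))

  no-long-periodic-run : ∀ {p I} → 0 < p → lo I + p ≤ hi I → ¬ Run (PeriodAt W p) I
  no-long-periodic-run 0<p long run = no-periodic-run 0<p (Run-⊆ (⊆-bounds ≤-refl long) run)

  no-adjacent-repeat : ∀ {x} → ¬ SameLetter W x (suc x)
  no-adjacent-repeat {x} same = no-periodic-run {z = x} z<s λ y (x≤y , y<x+1) →
    subst (PeriodAt W 1) (≤-antisym x≤y (≤-pred (subst (y <_) (+-comm x 1) y<x+1)))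
          (subst (SameLetter W x) (+-comm 1 x) same)

  period-difference : ∀ {p e x} → PeriodAt W p x → PeriodAt W (p + e) x → PeriodAt W e (x + p)
  period-difference {p} {e} {x} short long =
    SameLetter-trans (SameLetter-sym short) (subst (SameLetter W x) (sym (+-assoc x p e)) long)

  periods-incompatible : Conflicting (PeriodAt W)
  periods-incompatible {p} {e} {I} 0<e long run run′ =
    no-long-periodic-run {I = [ lo I + p , hi I + p ⟩} 0<e
      (≤-trans (≤-reflexive (xy∙z≈xz∙y (lo I) p e)) (+-monoˡ-≤ p long))
      λ y (lo+p≤y , y<hi+p) → subst (PeriodAt W e) (m∸n+n≡m (m+n≤o⇒n≤o (lo I) lo+p≤y))
        (period-difference (run (y ∸ p) (within lo+p≤y y<hi+p)) (run′ (y ∸ p) (within lo+p≤y y<hi+p)))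
    where
    within : ∀ {y} → lo I + p ≤ y → y < hi I + p → y ∸ p ∈ I
    within {y} lo+p≤y y<hi+p =
      m+n≤o⇒m≤o∸n (lo I) lo+p≤y ,
      +-cancelʳ-< p _ _ (subst (_< hi I + p) (sym (m∸n+n≡m (m+n≤o⇒n≤o (lo I) lo+p≤y))) y<hi+p)

-- Windows split into two periodic parts

record Split (P Q : ℕ → Set) (m t d : ℕ) : Set where
  field
    start≤split : t ≤ d
    split≤end   : d ≤ t + m
    left-run    : Run P [ t , d ⟩
    right-run   : Run Q [ d , t + m ⟩

record Incompatible (P Q : ℕ → Set) (m : ℕ) : Set where
  field
    short-P   : ∀ z → ¬ Run P [ z , suc z + m ⟩
    short-Q   : ∀ z → ¬ Run Q [ z , suc z + m ⟩
    exclusive : ∀ x → P x → Q x → ⊥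

module _ {P Q : ℕ → Set} {m} (inc : Incompatible P Q m) where
  open Incompatible inc

  -- If the windows overlapped, some point would carry both P and Q, or the P-parts (or the Q-parts)
  -- of the two splits would join into a run of length m + 1.
  splits-separated : ∀ {t d t′ d′} → Split P Q m t d → Split P Q m t′ d′ → d < d′ → t + m ≤ t′
  splits-separated {t} {d} {t′} {d′} S S′ d<d′ = ≮⇒≥ no-overlap
    where
    module S  = Split S
    module S′ = Split S′
    no-overlap : ¬ t′ < t + m
    no-overlap t′<t+m with d <? t + m
    ... | no d≮t+m = short-P t (Run-⊆ (⊆-bounds ≤-refl t+m<d′) (Run-join t′≤d S.left-run S′.left-run))
      where
      t′≤d = ≤-trans (<⇒≤ t′<t+m) (≮⇒≥ d≮t+m)
      t+m<d′ = <-≤-trans (s≤s (≮⇒≥ d≮t+m)) d<d′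
    ... | yes d<t+m with t′ ≤? d
    ...   | yes t′≤d = exclusive d (S′.left-run d (t′≤d , d<d′)) (S.right-run d (≤-refl , d<t+m))
    ...   | no  t′≰d with t′ <? d′
    ...     | yes t′<d′ =
      exclusive t′ (S′.left-run t′ (≤-refl , t′<d′)) (S.right-run t′ (<⇒≤ (≰⇒> t′≰d) , t′<t+m))
    ...     | no  t′≮d′ = short-Q d (Run-⊆ (⊆-bounds ≤-refl (+-monoˡ-≤ m (≰⇒> t′≰d)))
                                           (Run-join d′≤t+m S.right-run S′.right-run))
      where
      d′≤t+m = ≤-trans (≮⇒≥ t′≮d′) (<⇒≤ t′<t+m)

  splits-disjoint : ∀ {t d t′ d′} → Split P Q m t d → Split P Q m t′ d′ → d ≢ d′ →
    Disjoint [ t , t + m ⟩ [ t′ , t′ + m ⟩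
  splits-disjoint S S′ d≢d′ y (t≤y , y<t+m) (t′≤y , y<t′+m) with <-cmp _ _
  ... | tri< d<d′ _ _ = <-irrefl refl (<-≤-trans y<t+m (≤-trans (splits-separated S S′ d<d′) t′≤y))
  ... | tri≈ _ d≡d′ _ = d≢d′ d≡d′
  ... | tri> _ _ d′<d = <-irrefl refl (<-≤-trans y<t′+m (≤-trans (splits-separated S′ S d′<d) t≤y))

-- Anatomy of a square-completing quadruple

data Half : Set where
  first second : Half

data Side : Set where
  left right : Side

module _ {k : ℕ} where

  squareStart span : Quad k → ℕ
  squareStart q = qa q ∸ 1
  span  q = qℓ q ∸ 1

  window : Quad k → Interval
  window q = [ squareStart q , squareStart q + span q ⟩

  InHalf : Half → Quad k → Set
  InHalf first  q = qb q < squareStart q + qℓ q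
  InHalf second q = ¬ InHalf first q

  inHalf? : ∀ h q → Dec (InHalf h q)
  inHalf? first  q = qb q <? squareStart q + qℓ q
  inHalf? second q = ¬? (inHalf? first q)

  splitPoint : Half → Quad k → ℕ
  splitPoint first  q = qb q
  splitPoint second q = qb q ∸ qℓ q

  letterPosition : Half → Quad k → ℕ
  letterPosition first  q = qb q + span q
  letterPosition second q = splitPoint second q

  part : Side → Half → Quad k → Interval
  part left  h q = [ squareStart q , splitPoint h q ⟩
  part right h q = [ splitPoint h q , squareStart q + span q ⟩

module _ {k} {W : Word k} {b} {c : Fin k} (b≤n : b ≤ length W) where

  removeInserted-<< : ∀ {x y} → x < b → y < b → SameLetter (insertAt W b c) x y → SameLetter W x y
  removeInserted-<< x<b y<b = SameLetter-transport (at-insertAt-< c W b≤n x<b) (at-insertAt-< c W b≤n y<b)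

  removeInserted-<> : ∀ {x y} → x < b → b ≤ y → SameLetter (insertAt W b c) x (suc y) → SameLetter W x y
  removeInserted-<> x<b b≤y = SameLetter-transport (at-insertAt-< c W b≤n x<b) (at-insertAt-> c W b≤y)

  removeInserted->> : ∀ {x y} → b ≤ x → b ≤ y → SameLetter (insertAt W b c) (suc x) (suc y) → SameLetter W x y
  removeInserted->> b≤x b≤y = SameLetter-transport (at-insertAt-> c W b≤x) (at-insertAt-> c W b≤y)

module _ {k} (W : Word k) where

  -- The right part of the second half is read one position later: it is [d + 1, s + m + 1) in W.
  periodic : Side → Half → ℕ → ℕ → Set
  periodic left  first  m x = PeriodAt W m x
  periodic right first  m x = PeriodAt W (suc m) x
  periodic left  second m x = PeriodAt W (suc m) x
  periodic right second m x = PeriodAt W m (suc x)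

  record Anatomy (h : Half) (q : Quad k) : Set where
    field
      split  : Split (periodic left h (span q)) (periodic right h (span q)) (span q) (squareStart q) (splitPoint h q)
      letter : at W (letterPosition h q) ≡ just (qc q)

module _ {k} {W : Word k} where

  square-letters : ∀ {s ℓ b c} → SquareCompleting W (quad (suc s) ℓ b c) →
    Run (PeriodAt (insertAt W b c) ℓ) [ s , s + ℓ ⟩
  square-letters {s} {ℓ} {b} {c} (_ , _ , b≤n , _ , fits , halves) y (s≤y , y<s+ℓ) =
    subst (PeriodAt W′ ℓ) (m+[n∸m]≡n s≤y) (sameLetter a W′[s+t]≡a (trans (sym repeated) W′[s+t]≡a))
    where
    W′ = insertAt W b c
    t = y ∸ s
    t<ℓ : t < ℓ
    t<ℓ = +-cancelˡ-< s t ℓ (subst (_< s + ℓ) (sym (m+[n∸m]≡n s≤y)) y<s+ℓ)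
    in-range : s + t < length W′
    in-range = begin-strict
      s + t       <⟨ +-monoʳ-< s t<ℓ ⟩
      s + ℓ       ≤⟨ +-monoʳ-≤ s (m≤m+n ℓ (ℓ + 0)) ⟩
      s + 2 * ℓ   ≤⟨ ≤-pred (subst (suc s + 2 * ℓ ≤_) (+-comm (length W) 2) fits) ⟩
      suc (length W) ≡⟨ length-insertAt c W b≤n ⟨
      length W′   ∎
      where open ≤-Reasoning
    present : ∃[ a ] at W′ (s + t) ≡ just a
    present = at-just W′ in-range
    a = proj₁ present
    W′[s+t]≡a = proj₂ present
    second-length : suc s + 2 * ℓ ∸ suc (s + ℓ) ≡ ℓ
    second-length = begin
      suc s + 2 * ℓ ∸ (suc s + ℓ) ≡⟨ [m+n]∸[m+o]≡n∸o (suc s) (2 * ℓ) ℓ ⟩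
      ℓ + (ℓ + 0) ∸ ℓ             ≡⟨ m+n∸m≡n ℓ (ℓ + 0) ⟩
      ℓ + 0                       ≡⟨ +-identityʳ ℓ ⟩
      ℓ                           ∎
      where open ≡-Reasoning
    repeated : at W′ (s + t) ≡ at W′ (s + t + ℓ)
    repeated = begin
      at W′ (s + t)
        ≡⟨ at-factor W′ s (suc s + ℓ) (subst (t <_) (sym (m+n∸m≡n (suc s) ℓ)) t<ℓ) ⟨
      at (factor W′ (suc s) (suc s + ℓ)) t
        ≡⟨ cong (λ V → at V t) halves ⟩
      at (factor W′ (suc s + ℓ) (suc s + 2 * ℓ)) t
        ≡⟨ at-factor W′ (s + ℓ) (suc s + 2 * ℓ) (subst (t <_) (sym second-length) t<ℓ) ⟩
      at W′ (s + ℓ + t)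
        ≡⟨ cong (at W′) (xy∙z≈xz∙y s ℓ t) ⟩
      at W′ (s + t + ℓ)
        ∎
      where open ≡-Reasoning

  window-bound : ∀ {q} → SquareCompleting W q → hi (window q) ≤ length W
  window-bound {quad (suc s) (suc m) b c} (_ , _ , _ , _ , fits , _) = ≤-pred (begin
    suc (s + m)      ≡⟨ +-suc s m ⟨
    s + suc m        ≤⟨ +-monoʳ-≤ s (m≤m+n (suc m) (suc m + 0)) ⟩
    s + 2 * suc m    ≤⟨ ≤-pred (subst (suc s + 2 * suc m ≤_) (+-comm (length W) 2) fits) ⟩
    suc (length W)   ∎)
    where open ≤-Reasoning

  first-half-anatomy : ∀ {s m b c} (let q = quad (suc s) (suc m) b c) →
    SquareCompleting W q → InHalf first q → Anatomy W first q
  first-half-anatomy {s} {m} {b} {c} sc@(_ , s≤s s≤b , b≤n , _) b<s+ℓ = record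
    { split  = record
      { start≤split = s≤b
      ; split≤end   = b≤s+m
      ; left-run    = λ y (s≤y , y<b) →
          removeInserted-<> b≤n y<b (≤-trans b≤s+m (+-monoˡ-≤ m s≤y))
            (subst (SameLetter W′ y) (+-suc y m) (square y (s≤y , <-trans y<b b<s+ℓ)))
      ; right-run   = λ y (b≤y , y<s+m) →
          removeInserted->> b≤n b≤y (≤-trans b≤y (m≤m+n y (suc m)))
            (square (suc y) (≤-trans s≤b (≤-trans b≤y (n≤1+n y)) , subst (suc y <_) (sym (+-suc s m)) (s≤s y<s+m)))
      }
    ; letter = begin
        at W (b + m)          ≡⟨ at-insertAt-> c W (m≤m+n b m) ⟨
        at W′ (suc (b + m))   ≡⟨ cong (at W′) (+-suc b m) ⟨
        at W′ (b + suc m)     ≡⟨ SameLetter-at (square b (s≤b , b<s+ℓ)) (at-insertAt-≡ c W b≤n) ⟩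
        just c                ∎
    }
    where
    open ≡-Reasoning
    W′ = insertAt W b c
    square = square-letters sc
    b≤s+m : b ≤ s + m
    b≤s+m = ≤-pred (subst (b <_) (+-suc s m) b<s+ℓ)

module _ {k} {W : Word k} where

  positive-length : ∀ {q} → SquareCompleting W q → qℓ q ≡ suc (span q)
  positive-length {quad _ zero    _ _} (_ , _ , _ , () , _)
  positive-length {quad _ (suc m) _ _} _ = refl

  part-run : ∀ {h q} → Anatomy W h q → ∀ σ → Run (periodic W σ h (span q)) (part σ h q)
  part-run anatomy left  = Split.left-run  (Anatomy.split anatomy)
  part-run anatomy right = Split.right-run (Anatomy.split anatomy)

  part-within : ∀ {h q} → Anatomy W h q → ∀ σ → lo (window q) ≤ lo (part σ h q) × hi (part σ h q) ≤ hi (window q)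
  part-within anatomy left  = ≤-refl , Split.split≤end (Anatomy.split anatomy)
  part-within anatomy right = Split.start≤split (Anatomy.split anatomy) , ≤-refl

module _ {k} {W : Word k} (sf : SquareFree W) where

  second-half-anatomy : ∀ {s m b c} (let q = quad (suc s) (suc m) b c) →
    SquareCompleting W q → InHalf second q → Anatomy W second q
  second-half-anatomy {s} {m} {b} {c} sc@(_ , _ , b≤n , _) b≮s+ℓ = record
    { split  = record
      { start≤split = s≤d
      ; split≤end   = d≤s+m
      ; left-run    = λ y (s≤y , y<d) →
          removeInserted-<< b≤n (<-≤-trans y<d d≤b) (subst (y + suc m <_) (sym b≡d+ℓ) (+-monoˡ-< (suc m) y<d))
            (square y (s≤y , <-≤-trans y<d (<⇒≤ (≤-<-trans d≤s+m s+m<s+ℓ))))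
      ; right-run   = λ y (d≤y , y<s+m) →
          removeInserted-<> b≤n (<-≤-trans (≤-<-trans y<s+m s+m<s+ℓ) s+ℓ≤b)
            (≤-trans (≤-reflexive b≡d+ℓ) (≤-trans (+-monoˡ-≤ (suc m) d≤y) (≤-reflexive (+-suc y m))))
            (subst (SameLetter W′ (suc y)) (+-suc (suc y) m)
              (square (suc y) (≤-trans s≤d (≤-trans d≤y (n≤1+n y)) , subst (suc y <_) (sym (+-suc s m)) (s≤s y<s+m))))
      }
    ; letter = trans (sym (at-insertAt-< c W b≤n d<b))
                     (SameLetter-at (SameLetter-sym (square d (s≤d , ≤-<-trans d≤s+m s+m<s+ℓ)))
                       (trans (cong (at W′) (sym b≡d+ℓ)) (at-insertAt-≡ c W b≤n)))
    }
    where
    W′ = insertAt W b c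
    square = square-letters sc
    s+ℓ≤b : s + suc m ≤ b
    s+ℓ≤b = ≮⇒≥ b≮s+ℓ
    s+m<s+ℓ : s + m < s + suc m
    s+m<s+ℓ = +-monoʳ-< s (n<1+n m)
    d = b ∸ suc m
    b≡d+ℓ : b ≡ d + suc m
    b≡d+ℓ = sym (m∸n+n≡m (m+n≤o⇒n≤o s s+ℓ≤b))
    s≤d : s ≤ d
    s≤d = m+n≤o⇒m≤o∸n s s+ℓ≤b
    d<b : d < b
    d<b = subst (d <_) (sym b≡d+ℓ) (m<m+n d z<s)
    d≤b : d ≤ b
    d≤b = <⇒≤ d<b
    -- The square cannot lie entirely to the left of the inserted letter, W being square-free.
    b<end : b < s + suc m + suc m
    b<end = ≰⇒> λ end≤b → no-periodic-run sf z<s λ y (s≤y , y<s+ℓ) →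
      removeInserted-<< b≤n (<-≤-trans y<s+ℓ (≤-trans (m≤m+n _ (suc m)) end≤b))
                            (<-≤-trans (+-monoˡ-< (suc m) y<s+ℓ) end≤b)
        (square y (s≤y , y<s+ℓ))
    d≤s+m : d ≤ s + m
    d≤s+m = ≤-pred (subst (d <_) (+-suc s m)
              (+-cancelʳ-< (suc m) d (s + suc m) (subst (_< s + suc m + suc m) b≡d+ℓ b<end)))

  anatomy : ∀ {h q} → SquareCompleting W q → InHalf h q → Anatomy W h q
  anatomy {_}      {quad zero _ _ _}             (() , _)              _
  anatomy {_}      {quad (suc _) zero _ _}       (_ , _ , _ , () , _)  _
  anatomy {first}  {quad (suc _) (suc _) _ _} sc inH = first-half-anatomy sc inH
  anatomy {second} {quad (suc _) (suc _) _ _} sc inH = second-half-anatomy sc inH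

  letter-determined : ∀ {h q q′} → SquareCompleting W q → SquareCompleting W q′ → InHalf h q → InHalf h q′ →
    letterPosition h q ≡ letterPosition h q′ → qc q ≡ qc q′
  letter-determined {h} {q} {q′} sc sc′ inH inH′ same-position = just-injective (begin
    just (qc q)                  ≡⟨ Anatomy.letter (anatomy sc inH) ⟨
    at W (letterPosition h q)    ≡⟨ cong (at W) same-position ⟩
    at W (letterPosition h q′)   ≡⟨ Anatomy.letter (anatomy sc′ inH′) ⟩
    just (qc q′)                 ∎)
    where open ≡-Reasoning

  split-determines-bc : ∀ {h q q′} → SquareCompleting W q → SquareCompleting W q′ → InHalf h q → InHalf h q′ →
    qℓ q ≡ qℓ q′ → splitPoint h q ≡ splitPoint h q′ → bc q ≡ bc q′
  split-determines-bc {first} sc sc′ inH inH′ ℓ≡ℓ′ b≡b′ =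
    cong₂ _,_ b≡b′ (letter-determined sc sc′ inH inH′ (cong₂ _+_ b≡b′ (cong (_∸ 1) ℓ≡ℓ′)))
  split-determines-bc {second} {q} {q′} sc sc′ inH inH′ ℓ≡ℓ′ d≡d′ =
    cong₂ _,_ b≡b′ (letter-determined sc sc′ inH inH′ d≡d′)
    where
    gap : ∀ {q} → InHalf second q → qb q ≡ splitPoint second q + qℓ q
    gap {q} b≮s+ℓ = sym (m∸n+n≡m (≤-trans (m≤n+m (qℓ q) (squareStart q)) (≮⇒≥ b≮s+ℓ)))
    b≡b′ = trans (gap {q} inH) (trans (cong₂ _+_ d≡d′ ℓ≡ℓ′) (sym (gap {q′} inH′)))

  halves-incompatible : ∀ {m} → 0 < m → ∀ h → Incompatible (periodic W left h m) (periodic W right h m) m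
  halves-incompatible {m} 0<m first = record
    { short-P   = λ z → no-long-periodic-run sf 0<m (n≤1+n (z + m))
    ; short-Q   = λ z → no-long-periodic-run sf z<s (≤-reflexive (+-suc z m))
    ; exclusive = λ x period-m period-ℓ →
        no-adjacent-repeat sf (subst (SameLetter W (x + m)) (+-suc x m) (SameLetter-trans (SameLetter-sym period-m) period-ℓ))
    }
  halves-incompatible {m} 0<m second = record
    { short-P   = λ z → no-long-periodic-run sf z<s (≤-reflexive (+-suc z m))
    ; short-Q   = λ z run → no-long-periodic-run sf 0<m (n≤1+n (suc z + m)) (Run-suc run)
    ; exclusive = λ x period-ℓ period-m →
        no-adjacent-repeat sf (SameLetter-trans (subst (SameLetter W x) (+-suc x m) period-ℓ) (SameLetter-sym period-m))
    }

  windows-disjoint : ∀ {h q q′} → SquareCompleting W q → SquareCompleting W q′ → InHalf h q → InHalf h q′ →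
    qℓ q ≡ qℓ q′ → bc q ≢ bc q′ → Disjoint (window q) (window q′)
  windows-disjoint {q = quad zero _ _ _}       (() , _)             _ _ _ _ _
  windows-disjoint {q = quad (suc _) zero _ _} (_ , _ , _ , () , _) _ _ _ _ _
  windows-disjoint {q = quad (suc s) (suc zero) _ _} _ _ _ _ _ _ =
    empty-Disjoint _ (≤-reflexive (+-identityʳ s))
  windows-disjoint {h} {q = quad (suc _) (suc (suc _)) _ _} sc sc′ inH inH′ ℓ≡ℓ′@refl bc≢bc′ =
    splits-disjoint (halves-incompatible z<s h) (Anatomy.split (anatomy sc inH)) (Anatomy.split (anatomy sc′ inH′))
      (λ d≡d′ → bc≢bc′ (split-determines-bc sc sc′ inH inH′ ℓ≡ℓ′ d≡d′))

  periodic-conflicting : ∀ σ h → Conflicting (periodic W σ h)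
  periodic-conflicting left  first  = periods-incompatible sf
  periodic-conflicting right first  = periods-incompatible sf
  periodic-conflicting left  second = periods-incompatible sf
  periodic-conflicting right second 0<e long run run′ = periods-incompatible sf 0<e (s≤s long) (Run-suc run) (Run-suc run′)

-- Quadruples of one length

distinct-bc : ∀ {k} {W : Word k} (𝒜 : CompletingSet W) → AllPairs (λ q q′ → bc q ≢ bc q′) (elems 𝒜)
distinct-bc 𝒜 = AllPairs.map⁻ (bcDistinct 𝒜)

by-halves : ∀ {k c B} (ys : List (Quad k)) → (∀ h → length (filter (inHalf? h) ys) * c ≤ B) → length ys * c ≤ 2 * B
by-halves {c = c} {B} ys bound = begin
  length ys * c                   ≡⟨ cong (_* c) (length-filter-split (inHalf? first) ys) ⟩
  (#first + #second) * c          ≡⟨ *-distribʳ-+ c #first #second ⟩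
  #first * c + #second * c        ≤⟨ +-mono-≤ (bound first) (bound second) ⟩
  B + B                           ≡⟨ cong (B +_) (+-identityʳ B) ⟨
  2 * B                           ∎
  where
  open ≤-Reasoning
  #first = length (filter (inHalf? first) ys)
  #second = length (filter (inHalf? second) ys)

module _ {k} {W : Word k} (sf : SquareFree W) (L : ℕ) (h : Half) where

  InHalfOfLength : Quad k → Set
  InHalfOfLength q = (SquareCompleting W q × qℓ q ≡ L) × InHalf h q

  half-windows-bound : ∀ zs → All InHalfOfLength zs → AllPairs (λ q q′ → bc q ≢ bc q′) zs →
    length zs * (L ∸ 1) ≤ length W
  half-windows-bound zs props distinct = begin
    length zs * (L ∸ 1)              ≤⟨ length*c≤sum (width ∘ window) (All.map window-width props) ⟩
    sum (map (width ∘ window) zs)    ≡⟨ cong sum (map-∘ zs) ⟩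
    sum (map width (map window zs))  ≤⟨ disjoint-widths (All-map⁺ (All.map (λ ((sc , _) , _) → window-bound sc) props))
                                          (AllPairs.map⁺ (AllPairs-with-All disjoint props distinct)) ⟩
    length W                         ∎
    where
    open ≤-Reasoning
    window-width : ∀ {q} → InHalfOfLength q → L ∸ 1 ≤ width (window q)
    window-width {q} ((_ , refl) , _) = ≤-reflexive (sym (m+n∸m≡n (squareStart q) (span q)))
    disjoint : ∀ {q q′} → InHalfOfLength q → InHalfOfLength q′ → bc q ≢ bc q′ → Disjoint (window q) (window q′)
    disjoint ((sc , refl) , inH) ((sc′ , ℓ′≡L) , inH′) = windows-disjoint sf sc sc′ inH inH′ (sym ℓ′≡L)

countL-bound : ∀ {k} {W : Word k} → SquareFree W → ∀ (𝒜 : CompletingSet W) L → (L ∸ 1) * countL 𝒜 L ≤ 2 * length W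
countL-bound {W = W} sf 𝒜 L = begin
  (L ∸ 1) * length ys  ≡⟨ *-comm (L ∸ 1) (length ys) ⟩
  length ys * (L ∸ 1)  ≤⟨ by-halves ys (λ h → half-windows-bound sf L h _
                            (All-filter (inHalf? h) (All-filter ℓ≟L (allComp 𝒜)))
                            (AllPairs.filter⁺ _ (AllPairs.filter⁺ _ (distinct-bc 𝒜)))) ⟩
  2 * length W         ∎
  where
  open ≤-Reasoning
  ℓ≟L : ∀ q → Dec (qℓ q ≡ L)
  ℓ≟L q = qℓ q ≟ L
  ys = filter ℓ≟L (elems 𝒜)

-- Quadruples with lengths in [L, 2L)

InBucket : ∀ {k} → ℕ → ℕ → Quad k → Set
InBucket L₀ w q = L₀ ≤ qℓ q × qℓ q < L₀ + w

inBucket? : ∀ {k} L₀ w (q : Quad k) → Dec (InBucket L₀ w q)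
inBucket? L₀ w q = (L₀ ≤? qℓ q) ×-dec (qℓ q <? L₀ + w)

bucket-spread : ∀ {k L₀ r} {q q′ : Quad k} → InBucket L₀ (2 * suc r) q → InBucket L₀ (2 * suc r) q′ →
  qℓ q′ ≤ qℓ q + suc (2 * r)
bucket-spread {L₀ = L₀} {r} {q} {q′} (L₀≤ℓ , _) (_ , ℓ′<end) = ≤-pred (begin-strict
  qℓ q′              <⟨ ℓ′<end ⟩
  L₀ + 2 * suc r     ≤⟨ +-monoˡ-≤ (2 * suc r) L₀≤ℓ ⟩
  qℓ q + 2 * suc r   ≡⟨ regroup (qℓ q) r ⟩
  suc (qℓ q + suc (2 * r)) ∎)
  where
  open ≤-Reasoning
  regroup : ∀ ℓ r → ℓ + 2 * suc r ≡ suc (ℓ + suc (2 * r))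
  regroup = solve-∀

module _ {k} {W : Word k} (𝒜 : CompletingSet W) where

  sumCount-≤-bucket : ∀ L₀ w → sumCount 𝒜 L₀ w ≤ length (filter (inBucket? L₀ w) (elems 𝒜))
  sumCount-≤-bucket L₀ zero    = z≤n
  sumCount-≤-bucket L₀ (suc w) =
    ≤-trans (+-monoʳ-≤ (countL 𝒜 L₀) (sumCount-≤-bucket (suc L₀) w))
      (length-filter-⊎ (λ q → qℓ q ≟ L₀) (inBucket? (suc L₀) w) (inBucket? L₀ (suc w))
        (λ { refl (L₀<L₀ , _) → <-irrefl refl L₀<L₀ })
        (λ { refl → ≤-refl , m<m+n L₀ z<s })
        (λ {q} (L₀<ℓ , ℓ<end) → <⇒≤ L₀<ℓ , subst (qℓ q <_) (sym (+-suc L₀ w)) ℓ<end)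
        (elems 𝒜))

  sumCount-+ : ∀ L₀ a b → sumCount 𝒜 L₀ (a + b) ≡ sumCount 𝒜 L₀ a + sumCount 𝒜 (L₀ + a) b
  sumCount-+ L₀ zero    b = cong (λ L → sumCount 𝒜 L b) (sym (+-identityʳ L₀))
  sumCount-+ L₀ (suc a) b = begin
    C + sumCount 𝒜 (suc L₀) (a + b)                            ≡⟨ cong (C +_) (sumCount-+ (suc L₀) a b) ⟩
    C + (sumCount 𝒜 (suc L₀) a + sumCount 𝒜 (suc L₀ + a) b)  ≡⟨ +-assoc C _ _ ⟨
    C + sumCount 𝒜 (suc L₀) a + sumCount 𝒜 (suc L₀ + a) b    ≡⟨ cong (λ L → C + S₁ + sumCount 𝒜 L b) (+-suc L₀ a) ⟨
    C + sumCount 𝒜 (suc L₀) a + sumCount 𝒜 (L₀ + suc a) b    ∎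
    where
    open ≡-Reasoning
    C = countL 𝒜 L₀
    S₁ = sumCount 𝒜 (suc L₀) a

  sumCount-mono : ∀ L₀ {a b} → a ≤ b → sumCount 𝒜 L₀ a ≤ sumCount 𝒜 L₀ b
  sumCount-mono L₀ {a} {b} a≤b = begin
    sumCount 𝒜 L₀ a                                        ≤⟨ m≤m+n _ _ ⟩
    sumCount 𝒜 L₀ a + sumCount 𝒜 (L₀ + a) (b ∸ a)        ≡⟨ sumCount-+ L₀ a (b ∸ a) ⟨
    sumCount 𝒜 L₀ (a + (b ∸ a))                            ≡⟨ cong (sumCount 𝒜 L₀) (m+[n∸m]≡n a≤b) ⟩
    sumCount 𝒜 L₀ b                                        ∎
    where open ≤-Reasoning

module _ {k} {W : Word k} (sf : SquareFree W) (r L₀ : ℕ) (h : Half) where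

  InHalfBucket : Quad k → Set
  InHalfBucket q = (SquareCompleting W q × InBucket L₀ (2 * suc r) q) × InHalf h q

  bucket-spans : ∀ {q q′} → SquareCompleting W q → SquareCompleting W q′ →
    InBucket L₀ (2 * suc r) q → InBucket L₀ (2 * suc r) q′ → span q′ ≤ span q + suc (2 * r)
  bucket-spans {q} {q′} sc sc′ inB inB′ =
    ≤-pred (subst₂ _≤_ (positive-length sc′) (cong (_+ suc (2 * r)) (positive-length sc))
                       (bucket-spread {q = q} {q′} inB inB′))

  shrunk-parts-disjoint : ∀ σ {q q′} → InHalfBucket q → InHalfBucket q′ → bc q ≢ bc q′ →
    Disjoint (shrink r (part σ h q)) (shrink r (part σ h q′))
  shrunk-parts-disjoint σ {q} {q′} ((sc , inB) , inH) ((sc′ , inB′) , inH′) bc≢bc′ =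
    compare (<-cmp (span q) (span q′))
    where
    a : Anatomy W h q
    a = anatomy sf sc inH
    a′ : Anatomy W h q′
    a′ = anatomy sf sc′ inH′
    conflicting : Conflicting (periodic W σ h)
    conflicting = periodic-conflicting sf σ h
    in-window : ∀ {q} → Anatomy W h q → shrink r (part σ h q) ⊆ window q
    in-window anatomy = let lo≤ , ≤hi = part-within anatomy σ in λ y y∈ → ⊆-bounds lo≤ ≤hi y (shrink-⊆ r _ y y∈)
    compare : Tri (span q < span q′) (span q ≡ span q′) (span q′ < span q) →
      Disjoint (shrink r (part σ h q)) (shrink r (part σ h q′))
    compare (tri< m<m′ _ _) =
      shrunk-runs-disjoint {periodic W σ h} r conflicting (part-run a σ) (part-run a′ σ) m<m′ (bucket-spans sc sc′ inB inB′)
    compare (tri> _ _ m′<m) = Disjoint-sym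
      (shrunk-runs-disjoint {periodic W σ h} r conflicting (part-run a′ σ) (part-run a σ) m′<m (bucket-spans sc′ sc inB′ inB))
    compare (tri≈ _ m≡m′ _) =
      Disjoint-⊆ (in-window a) (in-window a′) (windows-disjoint sf sc sc′ inH inH′ ℓ≡ℓ′ bc≢bc′)
      where ℓ≡ℓ′ = trans (positive-length sc) (trans (cong suc m≡m′) (sym (positive-length sc′)))

  shrunk-parts-width : ∀ {q} → InHalfBucket q →
    L₀ ∸ suc (4 * r) ≤ width (shrink r (part left h q)) + width (shrink r (part right h q))
  shrunk-parts-width {q} ((sc , L₀≤ℓ , _) , inH) = begin
    L₀ ∸ suc (4 * r)    ≡⟨ ∸-+-assoc L₀ 1 (4 * r) ⟨
    L₀ ∸ 1 ∸ 4 * r      ≤⟨ ∸-monoˡ-≤ (4 * r) (∸-monoˡ-≤ 1 L₀≤ℓ) ⟩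
    span q ∸ 4 * r      ≤⟨ shrunk-split-widths r (Split.start≤split split) (Split.split≤end split) ⟩
    width (shrink r (part left h q)) + width (shrink r (part right h q)) ∎
    where
    open ≤-Reasoning
    split = Anatomy.split (anatomy sf sc inH)

  shrunk-parts-bound : ∀ σ zs → All InHalfBucket zs → AllPairs (λ q q′ → bc q ≢ bc q′) zs →
    sum (map (width ∘ shrink r ∘ part σ h) zs) ≤ length W
  shrunk-parts-bound σ zs props distinct = begin
    sum (map (width ∘ shrink r ∘ part σ h) zs)       ≡⟨ cong sum (map-∘ zs) ⟩
    sum (map width (map (shrink r ∘ part σ h) zs))   ≤⟨ disjoint-widths (All-map⁺ (All.map hi-bound props))
                                                          (AllPairs.map⁺ (AllPairs-with-All (shrunk-parts-disjoint σ) props distinct)) ⟩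
    length W                                         ∎
    where
    open ≤-Reasoning
    hi-bound : ∀ {q} → InHalfBucket q → hi (shrink r (part σ h q)) ≤ length W
    hi-bound ((sc , _) , inH) =
      ≤-trans (m∸n≤m _ r) (≤-trans (proj₂ (part-within (anatomy sf sc inH) σ)) (window-bound sc))

  half-bucket-bound : ∀ zs → All InHalfBucket zs → AllPairs (λ q q′ → bc q ≢ bc q′) zs →
    length zs * (L₀ ∸ suc (4 * r)) ≤ 2 * length W
  half-bucket-bound zs props distinct = begin
    length zs * (L₀ ∸ suc (4 * r))                          ≤⟨ length*c≤sum shrunk-widths (All.map shrunk-parts-width props) ⟩
    sum (map shrunk-widths zs)                               ≡⟨ sum-map-+ (shrunk-width left) (shrunk-width right) zs ⟩
    sum (map (shrunk-width left) zs) + sum (map (shrunk-width right) zs)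
                                                             ≤⟨ +-mono-≤ (shrunk-parts-bound left zs props distinct)
                                                                         (shrunk-parts-bound right zs props distinct) ⟩
    length W + length W                                      ≡⟨ cong (length W +_) (+-identityʳ (length W)) ⟨
    2 * length W                                             ∎
    where
    open ≤-Reasoning
    shrunk-width : Side → Quad k → ℕ
    shrunk-width σ = width ∘ shrink r ∘ part σ h
    shrunk-widths : Quad k → ℕ
    shrunk-widths q = shrunk-width left q + shrunk-width right q

eighth-bounds : ∀ L → 8 ≤ L → L ≤ 4 * (2 * suc (L / 8)) × L ≤ 3 * (L ∸ suc (4 * (L / 8)))
eighth-bounds L 8≤L with L / 8 | L % 8 | m≡m%n+[m/n]*n L 8 | m%n<n L 8
... | zero  | ρ | refl | ρ<8 = ⊥-elim (<⇒≱ ρ<8 (subst (8 ≤_) (+-identityʳ ρ) 8≤L))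
... | suc p | ρ | refl | ρ<8 =
  ≤-trans (+-monoˡ-≤ (suc p * 8) (<⇒≤ ρ<8)) (≤-reflexive (four-buckets p)) ,
  (begin
    ρ + suc p * 8                                  ≤⟨ m≤m+n _ _ ⟩
    ρ + suc p * 8 + (2 * ρ + 4 * p + 1)            ≡⟨ tripled ρ p ⟨
    3 * (ρ + 4 * p + 3)                            ≡⟨ cong (3 *_) (m+n∸n≡m (ρ + 4 * p + 3) (suc (4 * suc p))) ⟨
    3 * (ρ + 4 * p + 3 + suc (4 * suc p) ∸ suc (4 * suc p)) ≡⟨ cong (λ x → 3 * (x ∸ suc (4 * suc p))) (regroup ρ p) ⟩
    3 * (ρ + suc p * 8 ∸ suc (4 * suc p))          ∎)
  where
  open ≤-Reasoning
  four-buckets : ∀ p → 8 + suc p * 8 ≡ 4 * (2 * suc (suc p))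
  four-buckets = solve-∀
  tripled : ∀ ρ p → 3 * (ρ + 4 * p + 3) ≡ ρ + suc p * 8 + (2 * ρ + 4 * p + 1)
  tripled = solve-∀
  regroup : ∀ ρ p → ρ + 4 * p + 3 + suc (4 * suc p) ≡ ρ + suc p * 8
  regroup = solve-∀

module _ {k} {W : Word k} (sf : SquareFree W) (𝒜 : CompletingSet W) where

  bucket-bound : ∀ r L₀ → (L₀ ∸ suc (4 * r)) * sumCount 𝒜 L₀ (2 * suc r) ≤ 4 * length W
  bucket-bound r L₀ = begin
    λ₀ * sumCount 𝒜 L₀ (2 * suc r)  ≤⟨ *-monoʳ-≤ λ₀ (sumCount-≤-bucket 𝒜 L₀ (2 * suc r)) ⟩
    λ₀ * length ys                   ≡⟨ *-comm λ₀ (length ys) ⟩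
    length ys * λ₀                   ≤⟨ by-halves ys (λ h → half-bucket-bound sf r L₀ h _
                                           (All-filter (inHalf? h) (All-filter (inBucket? L₀ (2 * suc r)) (allComp 𝒜)))
                                           (AllPairs.filter⁺ _ (AllPairs.filter⁺ _ (distinct-bc 𝒜)))) ⟩
    2 * (2 * length W)               ≡⟨ *-assoc 2 2 (length W) ⟨
    4 * length W                     ∎
    where
    open ≤-Reasoning
    λ₀ = L₀ ∸ suc (4 * r)
    ys = filter (inBucket? L₀ (2 * suc r)) (elems 𝒜)

  buckets-bound : ∀ r j L₀ → (L₀ ∸ suc (4 * r)) * sumCount 𝒜 L₀ (j * (2 * suc r)) ≤ j * (4 * length W)
  buckets-bound r zero    L₀ = ≤-reflexive (*-zeroʳ (L₀ ∸ suc (4 * r)))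
  buckets-bound r (suc j) L₀ = begin
    λ₀ * sumCount 𝒜 L₀ (w + j * w)                                 ≡⟨ cong (λ₀ *_) (sumCount-+ 𝒜 L₀ w (j * w)) ⟩
    λ₀ * (sumCount 𝒜 L₀ w + sumCount 𝒜 (L₀ + w) (j * w))          ≡⟨ *-distribˡ-+ λ₀ _ _ ⟩
    λ₀ * sumCount 𝒜 L₀ w + λ₀ * sumCount 𝒜 (L₀ + w) (j * w)       ≤⟨ +-mono-≤ (bucket-bound r L₀)
                                                                         (*-monoˡ-≤ _ (∸-monoˡ-≤ (suc (4 * r)) (m≤m+n L₀ w))) ⟩
    4 * length W + λ₁ * sumCount 𝒜 (L₀ + w) (j * w)               ≤⟨ +-monoʳ-≤ (4 * length W) (buckets-bound r j (L₀ + w)) ⟩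
    4 * length W + j * (4 * length W)                               ∎
    where
    open ≤-Reasoning
    w = 2 * suc r
    λ₀ = L₀ ∸ suc (4 * r)
    λ₁ = L₀ + w ∸ suc (4 * r)

  sumCount-bound : ∀ L → 8 ≤ L → L * sumCount 𝒜 L L ≤ 48 * length W
  sumCount-bound L 8≤L = begin
    L * sumCount 𝒜 L L                 ≤⟨ *-mono-≤ L≤3λ (sumCount-mono 𝒜 L L≤4w) ⟩
    3 * λ₀ * sumCount 𝒜 L (4 * w)      ≡⟨ *-assoc 3 λ₀ _ ⟩
    3 * (λ₀ * sumCount 𝒜 L (4 * w))    ≤⟨ *-monoʳ-≤ 3 (buckets-bound (L / 8) 4 L) ⟩
    3 * (4 * (4 * length W))           ≡⟨ *-assoc 3 4 (4 * length W) ⟨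
    12 * (4 * length W)                ≡⟨ *-assoc 12 4 (length W) ⟨
    48 * length W                      ∎
    where
    open ≤-Reasoning
    w = 2 * suc (L / 8)
    λ₀ = L ∸ suc (4 * (L / 8))
    L≤4w = proj₁ (eighth-bounds L 8≤L)
    L≤3λ = proj₂ (eighth-bounds L 8≤L)

corollary2p3 : ∀ {k : ℕ} (W : Word k) → SquareFree W → (𝒜 : CompletingSet W) →
    (∀ L → 2 ≤ L → (L ∸ 1) * countL 𝒜 L ≤ 2 * length W) ×
    (∀ L → 300 ≤ L → L * sumCount 𝒜 L L ≤ 320 * length W)
corollary2p3 W sf 𝒜 =
  (λ L _ → countL-bound sf 𝒜 L) ,
  (λ L 300≤L → ≤-trans (sumCount-bound sf 𝒜 L (≤-trans (m≤m+n 8 292) 300≤L))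
                       (*-monoˡ-≤ (length W) (m≤m+n 48 272)))
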